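{- For every graph $G$ we have $w_T(G) \le \frac12$.
   Context: For a graph $G$ and an edge $e \in E(G)$, let $r(e)$ be the order of a largest clique of $G$ containing $e$. The Turán weights are $w_T(r) := \frac{r}{2(r-1)}$ for integers $r \ge 2$, and each edge $e$ is given weight $w_T(e) := w_T(r(e))$. For an $n$-vertex graph $G$, define $w_T(G) := \frac{2}{n^2}\sum_{e \in E(G)} w_T(e)$. -}

module Defs where

open import Data.Bool using (Bool; true; false; _∧_; _∨_; not; if_then_else_)
open import Data.Nat as ℕ using (ℕ; zero; suc; _⊔_; _<ᵇ_)
open import Data.Integer using (+_)
open import Data.Fin using (Fin; toℕ)
open import Data.Fin.Subset using (Subset; ∣_∣)
open import Data.Vec using (Vec; []; _∷_; lookup)
open import Data.List using (List; []; _∷_; _++_; map; foldr; allFin)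
open import Data.Bool.ListAction using (and)
open import Data.Rational using (ℚ; _/_; _+_; _*_; 0ℚ)
open import Relation.Binary.PropositionalEquality using (_≡_)
open import Relation.Nullary.Decidable using (⌊_⌋)
import Data.Fin as F

record Graph (n : ℕ) : Set where
  field
    adj    : Fin n → Fin n → Bool
    sym    : ∀ i j → adj i j ≡ adj j i
    irrefl : ∀ i → adj i i ≡ false
open Graph public

isClique : ∀ {n} → Graph n → Subset n → Bool
isClique {n} G S =
  and (map (λ i → and (map (λ j →
        not (lookup S i ∧ lookup S j) ∨ ⌊ i F.≟ j ⌋ ∨ adj G i j)
      (allFin n))) (allFin n))

subsets : ∀ n → List (Subset n)
subsets zero    = [] ∷ []
subsets (suc n) = map (true ∷_) (subsets n) ++ map (false ∷_) (subsets n)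

r : ∀ {n} → Graph n → Fin n → Fin n → ℕ
r {n} G i j =
  foldr _⊔_ 0 (map (λ S → if isClique G S ∧ lookup S i ∧ lookup S j
                            then ∣ S ∣ else 0) (subsets n))

-- Turán weight w_T(r) = r / (2(r-1)) for r ≥ 2 (value at r < 2 is never used,
-- since every edge lies in a clique of order ≥ 2).
wT : ℕ → ℚ
wT (suc (suc k)) = + (suc (suc k)) / (2 ℕ.* suc k)
wT _             = 0ℚ

sumℚ : List ℚ → ℚ
sumℚ = foldr _+_ 0ℚ

edgeWeightSum : ∀ {n} → Graph n → ℚ
edgeWeightSum {n} G =
  sumℚ (map (λ i → sumℚ (map (λ j →
          if adj G i j ∧ (toℕ i <ᵇ toℕ j) then wT (r G i j) else 0ℚ)
        (allFin n))) (allFin n))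

wTG : ∀ {m} → Graph (suc m) → ℚ
wTG {m} G = (+ 2 / (suc m ℕ.* suc m)) * edgeWeightSum G

module Submission where

-- For a vertex set U let S(U) be the total weight of the ordered pairs of adjacent
-- vertices of U.  Take a maximum clique K inside U.  If a vertex i ∈ U has d ≥ 1
-- neighbours in K, then these neighbours together with i form a clique of order
-- d + 1 ≤ |K|, so each of the d edges has weight at most w_T(d + 1), and together
-- they weigh at most d·w_T(d + 1) = (d + 1)/2 ≤ |K|/2.  Splitting U into K and U ∖ K
-- gives S(U) ≤ |U||K|/2 + |U ∖ K||K|/2 + S(U ∖ K), and induction on |U| yields
-- S(U) ≤ |U|²/2.  Finally S(V(G)) counts every edge twice, so S(V(G)) = n² w_T(G).

open import Algebra.Bundles using (Ring)
open import Data.Bool using (Bool; true; false; if_then_else_; _∧_; _∨_; not; T)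
open import Data.Bool.ListAction using (all)
open import Data.Bool.Properties using (T-≡; ∧-comm; ∧-zeroʳ; ∧-identityʳ)
open import Data.Fin using (Fin; zero; suc; toℕ; _≟_)
open import Data.Fin.Properties using (toℕ-injective)
open import Data.Fin.Subset
  using (Subset; inside; outside; ∣_∣; _∈_; _⊆_; Nonempty; ⊥; ⊤; ⁅_⁆; _∩_; _∪_; _─_)
open import Data.Fin.Subset.Properties
  using ( drop-∷-⊆; ∪-identityʳ; ∉⊥; ⊥⊆; _⊆?_; x∈p∩q⁻; x∈p∪q⁻; x∈p∪q⁺; x∈⁅x⁆; x∈⁅y⁆⇒x≡y
        ; ∣⁅x⁆∣≡1; ∣⊤∣≡n; x∈p⇒∣p-x∣<∣p∣; p─q⊆p; nonempty?; Empty-unique)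
import Data.Integer as ℤ
import Data.Integer.Properties as ℤ
open import Data.List using (List; _∷_; map; foldr; filter; allFin; tabulate)
import Data.List.Properties as List
open import Data.List.Extrema.Nat using (argmax; argmax-all; f[xs]≤f[argmax])
open import Data.List.Membership.Propositional using () renaming (_∈_ to _∈ˡ_)
open import Data.List.Membership.Propositional.Properties
  using (∈-allFin; ∈-map⁺; ∈-++⁺ˡ; ∈-++⁺ʳ; ∈-filter⁺)
open import Data.List.Relation.Unary.All as All using ()
open import Data.List.Relation.Unary.All.Properties using (all⁺; all⁻; all-filter)
open import Data.List.Relation.Unary.Any using (here; there)
open import Data.Nat as ℕ using (ℕ; zero; suc; _⊔_; _<ᵇ_)
open import Data.Nat.Induction using (<-wellFounded)
import Data.Nat.Properties as ℕ
open import Data.Nat.Tactic.RingSolver using (solve-∀)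
open import Data.Product using (_,_; proj₁; proj₂)
import Data.Product as Product
open import Data.Rational using (ℚ; 0ℚ; 1ℚ; ½; _+_; _*_; _/_; _≤_; _<_; toℚᵘ; positive)
open import Data.Rational.Properties
  using ( +-*-ring; toℚᵘ-homo-+; toℚᵘ-homo-*; toℚᵘ-fromℚᵘ; toℚᵘ-injective; toℚᵘ-cancel-≤
        ; ≤-refl; ≤-trans; ≤-reflexive; +-mono-≤; +-monoʳ-≤; +-mono-<-≤; +-identityˡ; +-identityʳ
        ; *-identityˡ; *-identityʳ; *-assoc; *-cancelˡ-≤-pos; positive⁻¹; nonNegative⁻¹
        ; module ≤-Reasoning)
open import Data.Rational.Solver using (module +-*-Solver)
open import Data.Rational.Unnormalised as ℚᵘ using (mkℚᵘ; *≡*; *≤*) renaming (_≃_ to _≃ᵘ_)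
import Data.Rational.Unnormalised.Properties as ℚᵘ
open import Data.Sum using (inj₁; inj₂)
open import Data.Vec as Vec using ([]; _∷_; lookup; here; there)
open import Data.Vec.Properties
  using (lookup⇒[]=; []=⇒lookup; lookup-zipWith; lookup∘tabulate; lookup-replicate)
open import Function using (_∘_; Equivalence)
open import Induction.WellFounded using (Acc; acc)
open import Relation.Binary.PropositionalEquality
  using (_≡_; _≢_; refl; sym; trans; cong; cong₂; subst; module ≡-Reasoning)
open import Relation.Nullary using (¬_; Dec; yes; no; contradiction)
open import Relation.Nullary.Decidable using (⌊_⌋; T?; _×-dec_)

open import Defs using (Graph; adj; isClique; subsets; r; wT; sumℚ; edgeWeightSum; wTG)

open import Algebra.Properties.Semiring.Mult (Ring.semiring +-*-ring)
  using (_×_; ×-homo-+; ×-assocˡ; ×-assoc-*; ×-comm-*; ×1-homo-*)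
open import Algebra.Properties.Semiring.Sum (Ring.semiring +-*-ring)
  using (sum; sum-syntax; ∑-distrib-+; ∑-comm; sum-cong-≗; sum-replicate-zero)

-- Rational arithmetic and the Turán weights

-- ℕ is embedded into ℚ as n ↦ n × 1ℚ (the n-fold sum of 1ℚ).

toℚᵘ-×1ℚ : ∀ a → toℚᵘ (a × 1ℚ) ≃ᵘ mkℚᵘ (ℤ.+ a) 0
toℚᵘ-×1ℚ zero    = *≡* refl
toℚᵘ-×1ℚ (suc a) = ℚᵘ.≃-trans (toℚᵘ-homo-+ 1ℚ (a × 1ℚ))
  (ℚᵘ.≃-trans (ℚᵘ.+-cong (ℚᵘ.≃-refl {ℚᵘ.1ℚᵘ}) (toℚᵘ-×1ℚ a)) (*≡* 1+a≡suc-a))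
  where
  1+a≡suc-a : (ℤ.+ 1 ℤ.* ℤ.+ 1 ℤ.+ ℤ.+ a ℤ.* ℤ.+ 1) ℤ.* ℤ.+ 1 ≡ ℤ.+ suc a ℤ.* ℤ.+ 1
  1+a≡suc-a rewrite ℤ.*-identityʳ (ℤ.+ 1 ℤ.+ ℤ.+ a ℤ.* ℤ.+ 1) | ℤ.*-identityʳ (ℤ.+ a)
    | ℤ.*-identityʳ (ℤ.+ suc a) = sym (ℤ.pos-+ 1 a)

×1ℚ-cancel-/ : ∀ a d → (suc d × 1ℚ) * (ℤ.+ a / suc d) ≡ a × 1ℚ
×1ℚ-cancel-/ a d = toℚᵘ-injective (ℚᵘ.≃-trans (toℚᵘ-homo-* (suc d × 1ℚ) (ℤ.+ a / suc d))
  (ℚᵘ.≃-trans (ℚᵘ.*-cong (toℚᵘ-×1ℚ (suc d)) (toℚᵘ-fromℚᵘ (mkℚᵘ (ℤ.+ a) d)))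
  (ℚᵘ.≃-trans (*≡* cross) (ℚᵘ.≃-sym (toℚᵘ-×1ℚ a)))))
  where
  cross : (ℤ.+ suc d ℤ.* ℤ.+ a) ℤ.* ℤ.+ 1 ≡ ℤ.+ a ℤ.* ℤ.+ suc (d ℕ.+ 0)
  cross rewrite ℕ.+-identityʳ d | ℤ.*-identityʳ (ℤ.+ suc d ℤ.* ℤ.+ a) = ℤ.*-comm (ℤ.+ suc d) (ℤ.+ a)

×≡×1ℚ* : ∀ n p → n × p ≡ (n × 1ℚ) * p
×≡×1ℚ* n p = trans (cong (n ×_) (sym (*-identityˡ p))) (sym (×-assoc-* n 1ℚ p))

×-nonNeg : ∀ {q} → 0ℚ ≤ q → ∀ n → 0ℚ ≤ n × q
×-nonNeg 0≤q zero    = ≤-refl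
×-nonNeg 0≤q (suc n) = +-mono-≤ 0≤q (×-nonNeg 0≤q n)

×-monoˡ-≤ : ∀ {q} → 0ℚ ≤ q → ∀ {m n} → m ℕ.≤ n → m × q ≤ n × q
×-monoˡ-≤ 0≤q {n = n} ℕ.z≤n       = ×-nonNeg 0≤q n
×-monoˡ-≤ {q} 0≤q     (ℕ.s≤s m≤n) = +-monoʳ-≤ q (×-monoˡ-≤ 0≤q m≤n)

0<[1+d]×1ℚ : ∀ d → 0ℚ < suc d × 1ℚ
0<[1+d]×1ℚ d = +-mono-<-≤ (positive⁻¹ 1ℚ) (×-nonNeg (nonNegative⁻¹ 1ℚ) d)

×-square-split : ∀ {s t u} → s ≡ t ℕ.+ u → ∀ q →
                 (s ℕ.* t) × q + ((u ℕ.* t) × q + (u ℕ.* u) × q) ≡ (s ℕ.* s) × q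
×-square-split {t = t} {u} refl q = begin
  ((t ℕ.+ u) ℕ.* t) × q + ((u ℕ.* t) × q + (u ℕ.* u) × q)
    ≡⟨ cong (((t ℕ.+ u) ℕ.* t) × q +_) (sym (×-homo-+ q (u ℕ.* t) (u ℕ.* u))) ⟩
  ((t ℕ.+ u) ℕ.* t) × q + (u ℕ.* t ℕ.+ u ℕ.* u) × q
    ≡⟨ sym (×-homo-+ q ((t ℕ.+ u) ℕ.* t) (u ℕ.* t ℕ.+ u ℕ.* u)) ⟩
  ((t ℕ.+ u) ℕ.* t ℕ.+ (u ℕ.* t ℕ.+ u ℕ.* u)) × q
    ≡⟨ cong (_× q) (square t u) ⟩
  ((t ℕ.+ u) ℕ.* (t ℕ.+ u)) × q ∎
  where
  open ≡-Reasoning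
  square : ∀ t u → (t ℕ.+ u) ℕ.* t ℕ.+ (u ℕ.* t ℕ.+ u ℕ.* u) ≡ (t ℕ.+ u) ℕ.* (t ℕ.+ u)
  square = solve-∀

wT-antitone : ∀ {a b} → 2 ℕ.≤ a → a ℕ.≤ b → wT b ≤ wT a
wT-antitone {suc (suc k)} (ℕ.s≤s (ℕ.s≤s _)) (ℕ.s≤s (ℕ.s≤s k≤m)) with ℕ.m≤n⇒∃[o]m+o≡n k≤m
... | e , refl = toℚᵘ-cancel-≤
  (ℚᵘ.≤-respˡ-≃ (ℚᵘ.≃-sym (toℚᵘ-fromℚᵘ (mkℚᵘ (ℤ.+ (2 ℕ.+ m)) (m ℕ.+ suc (m ℕ.+ 0)))))
  (ℚᵘ.≤-respʳ-≃ (ℚᵘ.≃-sym (toℚᵘ-fromℚᵘ (mkℚᵘ (ℤ.+ (2 ℕ.+ k)) (k ℕ.+ suc (k ℕ.+ 0)))))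
    (*≤* (ℤ.+≤+ (ℕ.≤-trans (ℕ.m≤m+n _ (e ℕ.+ e)) (ℕ.≤-reflexive (cross k e)))))))
  where
  m : ℕ
  m = k ℕ.+ e
  -- (m + 2)·2(k + 1) + 2e = (k + 2)·2(m + 1), the cross-multiplied inequality without subtraction.
  cross : ∀ k e → (2 ℕ.+ (k ℕ.+ e)) ℕ.* suc (k ℕ.+ suc (k ℕ.+ 0)) ℕ.+ (e ℕ.+ e)
                ≡ (2 ℕ.+ k) ℕ.* suc (k ℕ.+ e ℕ.+ suc (k ℕ.+ e ℕ.+ 0))
  cross = solve-∀

[1+k]×wT[2+k]≡[2+k]×½ : ∀ k → suc k × wT (2 ℕ.+ k) ≡ (2 ℕ.+ k) × ½
[1+k]×wT[2+k]≡[2+k]×½ k = begin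
  suc k × w                                 ≡⟨ ×≡×1ℚ* (suc k) w ⟩
  (suc k × 1ℚ) * w                          ≡⟨ solve 2 (λ x y → x :* y := con ½ :* ((con (2 × 1ℚ) :* x) :* y))
                                                 refl (suc k × 1ℚ) w ⟩
  ½ * ((2 × 1ℚ) * (suc k × 1ℚ) * w)         ≡⟨ cong (λ x → ½ * (x * w)) (sym (×1-homo-* 2 (suc k))) ⟩
  ½ * ((2 ℕ.* suc k) × 1ℚ * w)              ≡⟨ cong (½ *_) (×1ℚ-cancel-/ (2 ℕ.+ k) (k ℕ.+ 1 ℕ.* suc k)) ⟩
  ½ * ((2 ℕ.+ k) × 1ℚ)                      ≡⟨ ×-comm-* (2 ℕ.+ k) ½ 1ℚ ⟩
  (2 ℕ.+ k) × (½ * 1ℚ)                      ≡⟨ cong ((2 ℕ.+ k) ×_) (*-identityʳ ½) ⟩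
  (2 ℕ.+ k) × ½                             ∎
  where
  open ≡-Reasoning
  open +-*-Solver using (solve; _:*_; _:=_; con)
  w : ℚ
  w = wT (2 ℕ.+ k)

d<t⇒d×wT[1+d]≤t×½ : ∀ {d t} → d ℕ.< t → d × wT (suc d) ≤ t × ½
d<t⇒d×wT[1+d]≤t×½ {zero}  {t} _ = ×-nonNeg (nonNegative⁻¹ ½) t
d<t⇒d×wT[1+d]≤t×½ {suc k} d<t   =
  ≤-trans (≤-reflexive ([1+k]×wT[2+k]≡[2+k]×½ k)) (×-monoˡ-≤ (nonNegative⁻¹ ½) d<t)

2/[1+d]*E≤½ : ∀ d {E} → E + E ≤ suc d × ½ → (ℤ.+ 2 / suc d) * E ≤ ½
2/[1+d]*E≤½ d {E} 2E≤ = *-cancelˡ-≤-pos N {{positive (0<[1+d]×1ℚ d)}} (begin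
  N * ((ℤ.+ 2 / suc d) * E)  ≡⟨ sym (*-assoc N (ℤ.+ 2 / suc d) E) ⟩
  N * (ℤ.+ 2 / suc d) * E    ≡⟨ cong (_* E) (×1ℚ-cancel-/ 2 d) ⟩
  (2 × 1ℚ) * E               ≡⟨ sym (×≡×1ℚ* 2 E) ⟩
  2 × E                      ≡⟨ cong (E +_) (+-identityʳ E) ⟩
  E + E                      ≤⟨ 2E≤ ⟩
  suc d × ½                  ≡⟨ ×≡×1ℚ* (suc d) ½ ⟩
  N * ½                      ∎)
  where
  open ≤-Reasoning
  N : ℚ
  N = suc d × 1ℚ

-- Finite sums and subsets

∑-mono-≤ : ∀ {n} {f g : Fin n → ℚ} → (∀ i → f i ≤ g i) → sum f ≤ sum g
∑-mono-≤ {zero}  _   = ≤-refl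
∑-mono-≤ {suc n} f≤g = +-mono-≤ (f≤g zero) (∑-mono-≤ (f≤g ∘ suc))

∑-indicator : ∀ {n} (p : Subset n) c → ∑[ i < n ] (if lookup p i then c else 0ℚ) ≡ ∣ p ∣ × c
∑-indicator []            c = refl
∑-indicator (inside ∷ p)  c = cong (c +_) (∑-indicator p c)
∑-indicator (outside ∷ p) c = trans (+-identityˡ _) (∑-indicator p c)

sumℚ-allFin : ∀ {n} (f : Fin n → ℚ) → sumℚ (map f (allFin n)) ≡ sum f
sumℚ-allFin {n} f = trans (cong sumℚ (List.map-tabulate (λ i → i) f)) (sumℚ-tabulate f)
  where
  sumℚ-tabulate : ∀ {n} (f : Fin n → ℚ) → sumℚ (tabulate f) ≡ sum f
  sumℚ-tabulate {zero}  f = refl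
  sumℚ-tabulate {suc n} f = cong (f zero +_) (sumℚ-tabulate (f ∘ suc))

lookup-─ : ∀ {n} (p q : Subset n) j → lookup (p ─ q) j ≡ lookup p j ∧ not (lookup q j)
lookup-─ (x ∷ p) (inside  ∷ q) zero    = sym (∧-zeroʳ x)
lookup-─ (x ∷ p) (outside ∷ q) zero    = sym (∧-identityʳ x)
lookup-─ (x ∷ p) (y       ∷ q) (suc j) = lookup-─ p q j

∣p∣≡∣q∣+∣p─q∣ : ∀ {n} {p q : Subset n} → q ⊆ p → ∣ p ∣ ≡ ∣ q ∣ ℕ.+ ∣ p ─ q ∣
∣p∣≡∣q∣+∣p─q∣ {p = []}          {[]}          _   = refl
∣p∣≡∣q∣+∣p─q∣ {p = inside ∷ p}  {inside ∷ q}  q⊆p = cong suc (∣p∣≡∣q∣+∣p─q∣ (drop-∷-⊆ q⊆p))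
∣p∣≡∣q∣+∣p─q∣ {p = inside ∷ p}  {outside ∷ q} q⊆p =
  trans (cong suc (∣p∣≡∣q∣+∣p─q∣ (drop-∷-⊆ q⊆p))) (sym (ℕ.+-suc ∣ q ∣ ∣ p ─ q ∣))
∣p∣≡∣q∣+∣p─q∣ {p = outside ∷ p} {inside ∷ q}  q⊆p = contradiction (q⊆p here) λ ()
∣p∣≡∣q∣+∣p─q∣ {p = outside ∷ p} {outside ∷ q} q⊆p = ∣p∣≡∣q∣+∣p─q∣ (drop-∷-⊆ q⊆p)

x∉p⇒∣p∪⁅x⁆∣≡1+∣p∣ : ∀ {n} {x : Fin n} {p} → ¬ x ∈ p → ∣ p ∪ ⁅ x ⁆ ∣ ≡ suc ∣ p ∣
x∉p⇒∣p∪⁅x⁆∣≡1+∣p∣ {x = zero}  {inside ∷ p}  x∉p = contradiction here x∉p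
x∉p⇒∣p∪⁅x⁆∣≡1+∣p∣ {x = zero}  {outside ∷ p} x∉p = cong (suc ∘ ∣_∣) (∪-identityʳ p)
x∉p⇒∣p∪⁅x⁆∣≡1+∣p∣ {x = suc x} {inside ∷ p}  x∉p = cong suc (x∉p⇒∣p∪⁅x⁆∣≡1+∣p∣ (x∉p ∘ there))
x∉p⇒∣p∪⁅x⁆∣≡1+∣p∣ {x = suc x} {outside ∷ p} x∉p = x∉p⇒∣p∪⁅x⁆∣≡1+∣p∣ (x∉p ∘ there)

-- Cliques

∈-subsets : ∀ {n} (S : Subset n) → S ∈ˡ subsets n
∈-subsets []                    = here refl
∈-subsets {suc n} (inside ∷ S)  = ∈-++⁺ˡ (∈-map⁺ (inside ∷_) (∈-subsets S))
∈-subsets {suc n} (outside ∷ S) = ∈-++⁺ʳ (map (inside ∷_) (subsets n)) (∈-map⁺ (outside ∷_) (∈-subsets S))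

≤-foldr-⊔ : ∀ {x xs} → x ∈ˡ xs → x ℕ.≤ foldr _⊔_ 0 xs
≤-foldr-⊔ {xs = y ∷ _} (here refl)  = ℕ.m≤m⊔n y _
≤-foldr-⊔ {xs = y ∷ _} (there x∈xs) = ℕ.≤-trans (≤-foldr-⊔ x∈xs) (ℕ.m≤n⊔m y _)

IsClique : ∀ {n} → Graph n → Subset n → Set
IsClique G S = ∀ {i j} → i ∈ S → j ∈ S → i ≢ j → T (adj G i j)

module _ {n} (G : Graph n) (S : Subset n) where

  private
    clause : Fin n → Fin n → Bool
    clause i j = not (lookup S i ∧ lookup S j) ∨ ⌊ i ≟ j ⌋ ∨ adj G i j

    row : Fin n → Bool
    row i = all (clause i) (allFin n)

  isClique⁺ : IsClique G S → T (isClique G S)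
  isClique⁺ S-clique =
    all⁻ row {xs = allFin n} (All.tabulate λ {i} _ →
      all⁻ (clause i) {xs = allFin n} (All.tabulate λ {j} _ → clause-holds i j))
    where
    clause-holds : ∀ i j → T (clause i j)
    clause-holds i j with lookup S i in i∈S | lookup S j in j∈S | i ≟ j
    ... | false | _     | _       = _
    ... | true  | false | _       = _
    ... | true  | true  | yes _   = _
    ... | true  | true  | no  i≢j = S-clique (lookup⇒[]= i S i∈S) (lookup⇒[]= j S j∈S) i≢j

  isClique⁻ : T (isClique G S) → IsClique G S
  isClique⁻ S-clique {i} {j} i∈S j∈S i≢j =
    adjacent (All.lookup (all⁺ (clause i) _ (All.lookup (all⁺ row _ S-clique) (∈-allFin i))) (∈-allFin j))
    where
    adjacent : T (clause i j) → T (adj G i j)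
    adjacent holds rewrite []=⇒lookup i∈S | []=⇒lookup j∈S with i ≟ j
    ... | yes i≡j = contradiction i≡j i≢j
    ... | no  _   = holds

module _ {n} (G : Graph n) where

  ⁅i⁆-clique : ∀ i → IsClique G ⁅ i ⁆
  ⁅i⁆-clique i x∈⁅i⁆ y∈⁅i⁆ x≢y = contradiction (trans (x∈⁅y⁆⇒x≡y i x∈⁅i⁆) (sym (x∈⁅y⁆⇒x≡y i y∈⁅i⁆))) x≢y

  clique⇒∣S∣≤r : ∀ {S i j} → IsClique G S → i ∈ S → j ∈ S → ∣ S ∣ ℕ.≤ r G i j
  clique⇒∣S∣≤r {S} {i} {j} S-clique i∈S j∈S =
    subst (ℕ._≤ r G i j) counted (≤-foldr-⊔ (∈-map⁺ _ (∈-subsets S)))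
    where
    counted : (if isClique G S ∧ lookup S i ∧ lookup S j then ∣ S ∣ else 0) ≡ ∣ S ∣
    counted rewrite Equivalence.to T-≡ (isClique⁺ G S S-clique) | []=⇒lookup i∈S | []=⇒lookup j∈S = refl

  r-sym : ∀ i j → r G i j ≡ r G j i
  r-sym i j = cong (foldr _⊔_ 0) (List.map-cong swap (subsets n))
    where
    swap : ∀ S → (if isClique G S ∧ lookup S i ∧ lookup S j then ∣ S ∣ else 0)
               ≡ (if isClique G S ∧ lookup S j ∧ lookup S i then ∣ S ∣ else 0)
    swap S rewrite ∧-comm (lookup S i) (lookup S j) = refl

  record MaximumClique (U : Subset n) : Set where
    field
      K         : Subset n
      K-clique  : IsClique G K
      K⊆U       : K ⊆ U
      K-maximum : ∀ {C} → IsClique G C → C ⊆ U → ∣ C ∣ ℕ.≤ ∣ K ∣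

  maximumClique : ∀ U → MaximumClique U
  maximumClique U = record
    { K         = K
    ; K-clique  = isClique⁻ G K (proj₁ K-candidate)
    ; K⊆U       = proj₂ K-candidate
    ; K-maximum = λ {C} C-clique C⊆U → All.lookup (f[xs]≤f[argmax] ⊥ candidates)
                    (∈-filter⁺ candidate? (∈-subsets C) (isClique⁺ G C C-clique , C⊆U))
    }
    where
    Candidate : Subset n → Set
    Candidate S = T (isClique G S) Product.× S ⊆ U

    candidate? : ∀ S → Dec (Candidate S)
    candidate? S = T? (isClique G S) ×-dec S ⊆? U

    candidates : List (Subset n)
    candidates = filter candidate? (subsets n)

    K : Subset n
    K = argmax ∣_∣ ⊥ candidates

    K-candidate : Candidate K
    K-candidate = argmax-all ∣_∣ (isClique⁺ G ⊥ (λ i∈⊥ → contradiction i∈⊥ ∉⊥) , λ {_} → ⊥⊆)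
                    (all-filter candidate? (subsets n))

  neighbours : Fin n → Subset n
  neighbours i = Vec.tabulate (adj G i)

  ∈-neighbours⁻ : ∀ {i j} → j ∈ neighbours i → T (adj G i j)
  ∈-neighbours⁻ {i} {j} j∈nbrs =
    Equivalence.from T-≡ (trans (sym (lookup∘tabulate (adj G i) j)) ([]=⇒lookup j∈nbrs))

  ∉-neighbours : ∀ i → ¬ i ∈ neighbours i
  ∉-neighbours i i∈nbrs = subst T (Graph.irrefl G i) (∈-neighbours⁻ i∈nbrs)

-- Weight between two vertex sets

module Weights {n} (G : Graph n) where

  edgeWeight : Fin n → Fin n → ℚ
  edgeWeight i j = if adj G i j then wT (r G i j) else 0ℚ

  edgeWeight-sym : ∀ i j → edgeWeight i j ≡ edgeWeight j i
  edgeWeight-sym i j rewrite Graph.sym G i j | r-sym G i j = refl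

  arcWeight : Subset n → Subset n → Fin n → Fin n → ℚ
  arcWeight A B i j = if lookup A i ∧ lookup B j then edgeWeight i j else 0ℚ

  crossWeight : Subset n → Subset n → ℚ
  crossWeight A B = ∑[ i < n ] ∑[ j < n ] arcWeight A B i j

  crossWeight-comm : ∀ A B → crossWeight A B ≡ crossWeight B A
  crossWeight-comm A B = trans (∑-comm {n} {n} (arcWeight A B)) (sum-cong-≗ λ j → sum-cong-≗ λ i → swap i j)
    where
    swap : ∀ i j → arcWeight A B i j ≡ arcWeight B A j i
    swap i j rewrite ∧-comm (lookup A i) (lookup B j) | edgeWeight-sym i j = refl

  crossWeight-splitʳ : ∀ A {p q} → q ⊆ p → crossWeight A p ≡ crossWeight A q + crossWeight A (p ─ q)
  crossWeight-splitʳ A {p} {q} q⊆p =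
    trans (sum-cong-≗ λ i → trans (sum-cong-≗ (split i))
                                  (∑-distrib-+ (arcWeight A q i) (arcWeight A (p ─ q) i)))
          (∑-distrib-+ (λ i → ∑[ j < n ] arcWeight A q i j) (λ i → ∑[ j < n ] arcWeight A (p ─ q) i j))
    where
    split : ∀ i j → arcWeight A p i j ≡ arcWeight A q i j + arcWeight A (p ─ q) i j
    split i j rewrite lookup-─ p q j with lookup A i | lookup q j in j∈q | lookup p j in j∈p
    ... | false | _     | _     = refl
    ... | true  | false | false = refl
    ... | true  | false | true  = sym (+-identityˡ _)
    ... | true  | true  | true  = sym (+-identityʳ _)
    ... | true  | true  | false =
      contradiction (trans (sym ([]=⇒lookup (q⊆p (lookup⇒[]= j q j∈q)))) j∈p) λ ()

  crossWeight-decompose : ∀ {U K} → K ⊆ U →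
    crossWeight U U ≡ crossWeight U K + (crossWeight (U ─ K) K + crossWeight (U ─ K) (U ─ K))
  crossWeight-decompose {U} {K} K⊆U = begin
    crossWeight U U                         ≡⟨ crossWeight-splitʳ U K⊆U ⟩
    crossWeight U K + crossWeight U (U ─ K) ≡⟨ cong (crossWeight U K +_) (crossWeight-comm U (U ─ K)) ⟩
    crossWeight U K + crossWeight (U ─ K) U ≡⟨ cong (crossWeight U K +_) (crossWeight-splitʳ (U ─ K) K⊆U) ⟩
    crossWeight U K + (crossWeight (U ─ K) K + crossWeight (U ─ K) (U ─ K)) ∎
    where open ≡-Reasoning

  crossWeight-⊥ˡ : ∀ B → crossWeight ⊥ B ≡ 0ℚ
  crossWeight-⊥ˡ B = trans
    (sum-cong-≗ λ i → trans
      (sum-cong-≗ λ j → cong (λ b → if b ∧ lookup B j then edgeWeight i j else 0ℚ) (lookup-replicate i false))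
      (sum-replicate-zero n))
    (sum-replicate-zero n)

  module _ {U} (M : MaximumClique G U) where
    open MaximumClique M

    -- With N the neighbours of i in K, the set N ∪ {i} is again a clique inside U, so
    -- |N| < |K|, and every edge from i into N lies in a clique of order |N| + 1.
    neighbourWeight-≤ : ∀ {i} → i ∈ U → ∑[ j < n ] (if lookup K j then edgeWeight i j else 0ℚ) ≤ ∣ K ∣ × ½
    neighbourWeight-≤ {i} i∈U = begin
      ∑[ j < n ] (if lookup K j then edgeWeight i j else 0ℚ)  ≤⟨ ∑-mono-≤ arc-≤ ⟩
      ∑[ j < n ] (if lookup N j then wT (suc ∣ N ∣) else 0ℚ)  ≡⟨ ∑-indicator N _ ⟩
      ∣ N ∣ × wT (suc ∣ N ∣)                                  ≤⟨ d<t⇒d×wT[1+d]≤t×½ ∣N∣<∣K∣ ⟩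
      ∣ K ∣ × ½                                               ∎
      where
      open ≤-Reasoning
      N : Subset n
      N = K ∩ neighbours G i

      C : Subset n
      C = N ∪ ⁅ i ⁆

      N⊆K : N ⊆ K
      N⊆K x∈N = proj₁ (x∈p∩q⁻ K (neighbours G i) x∈N)

      adjacent : ∀ {x} → x ∈ N → T (adj G i x)
      adjacent x∈N = ∈-neighbours⁻ G (proj₂ (x∈p∩q⁻ K (neighbours G i) x∈N))

      C-clique : IsClique G C
      C-clique {x} {y} x∈C y∈C x≢y with x∈p∪q⁻ N ⁅ i ⁆ x∈C | x∈p∪q⁻ N ⁅ i ⁆ y∈C
      ... | inj₁ x∈N   | inj₁ y∈N   = K-clique (N⊆K x∈N) (N⊆K y∈N) x≢y
      ... | inj₁ x∈N   | inj₂ y∈⁅i⁆ rewrite x∈⁅y⁆⇒x≡y i y∈⁅i⁆ = subst T (Graph.sym G i x) (adjacent x∈N)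
      ... | inj₂ x∈⁅i⁆ | inj₁ y∈N   rewrite x∈⁅y⁆⇒x≡y i x∈⁅i⁆ = adjacent y∈N
      ... | inj₂ x∈⁅i⁆ | inj₂ y∈⁅i⁆ = ⁅i⁆-clique G i x∈⁅i⁆ y∈⁅i⁆ x≢y

      C⊆U : C ⊆ U
      C⊆U x∈C with x∈p∪q⁻ N ⁅ i ⁆ x∈C
      ... | inj₁ x∈N   = K⊆U (N⊆K x∈N)
      ... | inj₂ x∈⁅i⁆ rewrite x∈⁅y⁆⇒x≡y i x∈⁅i⁆ = i∈U

      ∣C∣≡1+∣N∣ : ∣ C ∣ ≡ suc ∣ N ∣
      ∣C∣≡1+∣N∣ = x∉p⇒∣p∪⁅x⁆∣≡1+∣p∣ {x = i} {p = N} (∉-neighbours G i ∘ proj₂ ∘ x∈p∩q⁻ K (neighbours G i))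

      ∣N∣<∣K∣ : ∣ N ∣ ℕ.< ∣ K ∣
      ∣N∣<∣K∣ = subst (ℕ._≤ ∣ K ∣) ∣C∣≡1+∣N∣ (K-maximum C-clique C⊆U)

      lookup-N : ∀ j → lookup N j ≡ lookup K j ∧ adj G i j
      lookup-N j = trans (lookup-zipWith _∧_ j K (neighbours G i))
                         (cong (lookup K j ∧_) (lookup∘tabulate (adj G i) j))

      arc-≤ : ∀ j → (if lookup K j then edgeWeight i j else 0ℚ) ≤ (if lookup N j then wT (suc ∣ N ∣) else 0ℚ)
      arc-≤ j rewrite lookup-N j with lookup K j in j∈K | adj G i j in i~j
      ... | false | _     = ≤-refl
      ... | true  | false = ≤-refl
      ... | true  | true  = wT-antitone 2≤1+∣N∣ 1+∣N∣≤r
        where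
        j∈N : j ∈ N
        j∈N = lookup⇒[]= j N (trans (lookup-N j) (cong₂ _∧_ j∈K i~j))

        2≤1+∣N∣ : 2 ℕ.≤ suc ∣ N ∣
        2≤1+∣N∣ = ℕ.s≤s (ℕ.≤-trans (ℕ.s≤s ℕ.z≤n) (x∈p⇒∣p-x∣<∣p∣ j∈N))

        1+∣N∣≤r : suc ∣ N ∣ ℕ.≤ r G i j
        1+∣N∣≤r = subst (ℕ._≤ r G i j) ∣C∣≡1+∣N∣
                    (clique⇒∣S∣≤r G C-clique (x∈p∪q⁺ (inj₂ (x∈⁅x⁆ i))) (x∈p∪q⁺ (inj₁ j∈N)))

    crossWeight-clique-≤ : ∀ {A} → A ⊆ U → crossWeight A K ≤ (∣ A ∣ ℕ.* ∣ K ∣) × ½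
    crossWeight-clique-≤ {A} A⊆U = begin
      crossWeight A K                                     ≤⟨ ∑-mono-≤ row-≤ ⟩
      ∑[ i < n ] (if lookup A i then ∣ K ∣ × ½ else 0ℚ)   ≡⟨ ∑-indicator A _ ⟩
      ∣ A ∣ × (∣ K ∣ × ½)                                 ≡⟨ ×-assocˡ ½ ∣ A ∣ ∣ K ∣ ⟩
      (∣ A ∣ ℕ.* ∣ K ∣) × ½                               ∎
      where
      open ≤-Reasoning
      row-≤ : ∀ i → ∑[ j < n ] arcWeight A K i j ≤ (if lookup A i then ∣ K ∣ × ½ else 0ℚ)
      row-≤ i with lookup A i in i∈A
      ... | true  = neighbourWeight-≤ (A⊆U (lookup⇒[]= i A i∈A))
      ... | false = ≤-reflexive (sum-replicate-zero n)

  crossWeight-self-≤-step : ∀ {U} → Nonempty U →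
    (∀ {V} → ∣ V ∣ ℕ.< ∣ U ∣ → crossWeight V V ≤ (∣ V ∣ ℕ.* ∣ V ∣) × ½) →
    crossWeight U U ≤ (∣ U ∣ ℕ.* ∣ U ∣) × ½
  crossWeight-self-≤-step {U} (i , i∈U) smaller = begin
    crossWeight U U
      ≡⟨ crossWeight-decompose K⊆U ⟩
    crossWeight U K + (crossWeight U′ K + crossWeight U′ U′)
      ≤⟨ +-mono-≤ (crossWeight-clique-≤ M (λ x∈U → x∈U))
           (+-mono-≤ (crossWeight-clique-≤ M (p─q⊆p U K)) (smaller {U′} ∣U′∣<∣U∣)) ⟩
    (∣ U ∣ ℕ.* ∣ K ∣) × ½ + ((∣ U′ ∣ ℕ.* ∣ K ∣) × ½ + (∣ U′ ∣ ℕ.* ∣ U′ ∣) × ½)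
      ≡⟨ ×-square-split ∣U∣≡∣K∣+∣U′∣ ½ ⟩
    (∣ U ∣ ℕ.* ∣ U ∣) × ½ ∎
    where
    open ≤-Reasoning
    M : MaximumClique G U
    M = maximumClique G U
    open MaximumClique M

    U′ : Subset n
    U′ = U ─ K

    ∣U∣≡∣K∣+∣U′∣ : ∣ U ∣ ≡ ∣ K ∣ ℕ.+ ∣ U′ ∣
    ∣U∣≡∣K∣+∣U′∣ = ∣p∣≡∣q∣+∣p─q∣ K⊆U

    1≤∣K∣ : 1 ℕ.≤ ∣ K ∣
    1≤∣K∣ = subst (ℕ._≤ ∣ K ∣) (∣⁅x⁆∣≡1 i)
      (K-maximum (⁅i⁆-clique G i) λ x∈⁅i⁆ → subst (_∈ U) (sym (x∈⁅y⁆⇒x≡y i x∈⁅i⁆)) i∈U)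

    ∣U′∣<∣U∣ : ∣ U′ ∣ ℕ.< ∣ U ∣
    ∣U′∣<∣U∣ = subst (∣ U′ ∣ ℕ.<_) (sym ∣U∣≡∣K∣+∣U′∣) (ℕ.+-monoˡ-≤ ∣ U′ ∣ 1≤∣K∣)

  crossWeight-self-≤ : ∀ U → crossWeight U U ≤ (∣ U ∣ ℕ.* ∣ U ∣) × ½
  crossWeight-self-≤ U = go U (<-wellFounded ∣ U ∣)
    where
    go : ∀ U → Acc ℕ._<_ ∣ U ∣ → crossWeight U U ≤ (∣ U ∣ ℕ.* ∣ U ∣) × ½
    go U (acc smaller) with nonempty? U
    ... | yes U≢∅ = crossWeight-self-≤-step U≢∅ λ {V} ∣V∣<∣U∣ → go V (smaller ∣V∣<∣U∣)
    ... | no  U≡∅ rewrite Empty-unique U≡∅ =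
      ≤-trans (≤-reflexive (crossWeight-⊥ˡ ⊥)) (×-nonNeg (nonNegative⁻¹ ½) (∣ ⊥ {n} ∣ ℕ.* ∣ ⊥ {n} ∣))

  forwardWeight : Fin n → Fin n → ℚ
  forwardWeight i j = if adj G i j ∧ (toℕ i <ᵇ toℕ j) then wT (r G i j) else 0ℚ

  edgeWeight≡forward+backward : ∀ i j → edgeWeight i j ≡ forwardWeight i j + forwardWeight j i
  edgeWeight≡forward+backward i j rewrite Graph.sym G j i | r-sym G j i
    with adj G i j in i~j | toℕ i <ᵇ toℕ j in i<ᵇj | toℕ j <ᵇ toℕ i in j<ᵇi
  ... | false | _     | _     = refl
  ... | true  | true  | false = sym (+-identityʳ _)
  ... | true  | false | true  = sym (+-identityˡ _)
  ... | true  | true  | true  =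
    contradiction (ℕ.<ᵇ⇒< (toℕ j) (toℕ i) (subst T (sym j<ᵇi) _))
                  (ℕ.<⇒≯ (ℕ.<ᵇ⇒< (toℕ i) (toℕ j) (subst T (sym i<ᵇj) _)))
  ... | true  | false | false =
    contradiction (trans (sym i~j) (subst (λ k → adj G i k ≡ false) i≡j (Graph.irrefl G i))) λ ()
    where
    i≡j : i ≡ j
    i≡j = toℕ-injective (ℕ.≤-antisym (ℕ.≮⇒≥ (subst T j<ᵇi ∘ ℕ.<⇒<ᵇ)) (ℕ.≮⇒≥ (subst T i<ᵇj ∘ ℕ.<⇒<ᵇ)))

  edgeWeightSum≡∑∑forwardWeight : edgeWeightSum G ≡ ∑[ i < n ] ∑[ j < n ] forwardWeight i j
  edgeWeightSum≡∑∑forwardWeight =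
    trans (cong sumℚ (List.map-cong (λ i → sumℚ-allFin (forwardWeight i)) (allFin n)))
          (sumℚ-allFin (λ i → ∑[ j < n ] forwardWeight i j))

  crossWeight-⊤ : crossWeight ⊤ ⊤ ≡ edgeWeightSum G + edgeWeightSum G
  crossWeight-⊤ = begin
    crossWeight ⊤ ⊤
      ≡⟨ (sum-cong-≗ λ i → sum-cong-≗ λ j → trans (arcWeight-⊤ i j) (edgeWeight≡forward+backward i j)) ⟩
    ∑[ i < n ] ∑[ j < n ] (forwardWeight i j + forwardWeight j i)
      ≡⟨ trans (sum-cong-≗ λ i → ∑-distrib-+ (forwardWeight i) (λ j → forwardWeight j i))
               (∑-distrib-+ (λ i → ∑[ j < n ] forwardWeight i j) (λ i → ∑[ j < n ] forwardWeight j i)) ⟩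
    ∑[ i < n ] ∑[ j < n ] forwardWeight i j + ∑[ i < n ] ∑[ j < n ] forwardWeight j i
      ≡⟨ cong (∑[ i < n ] ∑[ j < n ] forwardWeight i j +_) (sym (∑-comm {n} {n} forwardWeight)) ⟩
    ∑[ i < n ] ∑[ j < n ] forwardWeight i j + ∑[ i < n ] ∑[ j < n ] forwardWeight i j
      ≡⟨ sym (cong₂ _+_ edgeWeightSum≡∑∑forwardWeight edgeWeightSum≡∑∑forwardWeight) ⟩
    edgeWeightSum G + edgeWeightSum G ∎
    where
    open ≡-Reasoning
    arcWeight-⊤ : ∀ i j → arcWeight ⊤ ⊤ i j ≡ edgeWeight i j
    arcWeight-⊤ i j rewrite lookup-replicate i true | lookup-replicate j true = refl

-- The denominator (suc m)² of wTG G computes to suc (m ℕ.+ m ℕ.* suc m).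
theorem1p6 : ∀ (m : ℕ) (G : Graph (suc m)) → wTG G ≤ ½
theorem1p6 m G = 2/[1+d]*E≤½ (m ℕ.+ m ℕ.* suc m) (begin
  edgeWeightSum G + edgeWeightSum G      ≡⟨ sym crossWeight-⊤ ⟩
  crossWeight ⊤ ⊤                        ≤⟨ crossWeight-self-≤ ⊤ ⟩
  (∣ ⊤ {suc m} ∣ ℕ.* ∣ ⊤ {suc m} ∣) × ½  ≡⟨ cong (λ k → (k ℕ.* k) × ½) (∣⊤∣≡n (suc m)) ⟩
  (suc m ℕ.* suc m) × ½                  ∎)
  where
  open ≤-Reasoning
  open Weights G
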